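{- Let $p$ be an odd prime, $H$ a finite abelian group, and $\alpha,\beta\in\{1,2\}$. Let $G_1\cong \mathbb{Z}_p\oplus H\oplus\mathbb{Z}_{2^{\alpha-1}}\oplus\mathbb{Z}_{2^{\beta-1}}$ and $G_2\cong\mathbb{Z}_p\oplus H\oplus\mathbb{Z}_{2^{\alpha}}\oplus\mathbb{Z}_{2^{\beta}}$. If there exists an MRS$^*_{G_1}(p,4;|G_1|/(4p))$, then there exists an MRS$^*_{G_2}(p,4;|G_2|/(4p))$.
   Context: $\mathbb{Z}_v$ denotes the additive group of integers modulo $v$ ($\mathbb{Z}_1$ is the trivial group). For a finite abelian group $(G,+)$ of order $xyz$, an MRS$^*_G(x,y;z)$ is a collection of $z$ arrays of size $x\times y$ whose entries are elements of $G$, each element of $G$ appearing exactly once among all the arrays, such that every row sum and every column sum in every array equals $0$. -}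

module Defs where

open import Level using (Level; _⊔_; 0ℓ)
open import Data.Nat using (ℕ; zero; suc; _+_; _*_; _∸_; _^_)
open import Data.Nat.DivMod using (_%_; _/_; m%n<n)
open import Data.Fin using (Fin; toℕ; fromℕ<) renaming (zero to fzero; suc to fsuc)
open import Data.Product using (_×_; _,_; Σ)
open import Relation.Binary.Core using (Rel)
open import Relation.Binary.PropositionalEquality using (_≡_)
open import Function.Definitions using (Bijective)
open import Algebra.Bundles using (AbelianGroup)

-- Minimal "additive structure": carrier, equality, addition, zero.
-- This is all the data the notion MRS* refers to.
record AddStr (c ℓ : Level) : Set (Level.suc (c ⊔ ℓ)) where
  field
    Carrier : Set c
    _≈_     : Rel Carrier ℓ
    _∙_     : Carrier → Carrier → Carrier
    0#      : Carrier

fromAbelianGroup : ∀ {c ℓ} → AbelianGroup c ℓ → AddStr c ℓ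
fromAbelianGroup H = record
  { Carrier = AbelianGroup.Carrier H
  ; _≈_ = AbelianGroup._≈_ H
  ; _∙_ = AbelianGroup._∙_ H
  ; 0# = AbelianGroup.ε H }

addMod : ∀ {v} → Fin v → Fin v → Fin v
addMod {suc m} a b = fromℕ< (m%n<n (toℕ a + toℕ b) (suc m))

ZmodSuc : ℕ → AddStr 0ℓ 0ℓ
ZmodSuc m = record
  { Carrier = Fin (suc m) ; _≈_ = _≡_ ; _∙_ = addMod ; 0# = fzero }

-- Z_v for v ≥ 1, written with v itself. (Z 0 is never used: only v = p prime
-- and v = 2^k occur; it is arbitrarily set to the trivial group.)
Z : ℕ → AddStr 0ℓ 0ℓ
Z zero    = ZmodSuc 0
Z (suc m) = ZmodSuc m

_⊕_ : ∀ {c₁ ℓ₁ c₂ ℓ₂} → AddStr c₁ ℓ₁ → AddStr c₂ ℓ₂ → AddStr (c₁ ⊔ c₂) (ℓ₁ ⊔ ℓ₂)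
A ⊕ B = record
  { Carrier = A.Carrier × B.Carrier
  ; _≈_ = λ { (a , b) (a' , b') → A._≈_ a a' × B._≈_ b b' }
  ; _∙_ = λ { (a , b) (a' , b') → (A._∙_ a a' , B._∙_ b b') }
  ; 0# = (A.0# , B.0#) }
  where
    module A = AddStr A
    module B = AddStr B
infixr 5 _⊕_

sumF : ∀ {c ℓ} (G : AddStr c ℓ) {n : ℕ} → (Fin n → AddStr.Carrier G) → AddStr.Carrier G
sumF G {zero}  f = AddStr.0# G
sumF G {suc n} f = AddStr._∙_ G (f fzero) (sumF G (λ i → f (fsuc i)))

HasOrder : ∀ {c ℓ} → AbelianGroup c ℓ → ℕ → Set (c ⊔ ℓ)
HasOrder H n = Σ (Fin n → AbelianGroup.Carrier H)
                 (λ f → Bijective _≡_ (AbelianGroup._≈_ H) f)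

-- MRS*_G(x,y;z): z arrays of size x × y (array k, row i, column j) with
-- entries in G, every element of G appearing exactly once among all entries
-- (the entry map Fin z × Fin x × Fin y → G is a bijection), and every row
-- sum and every column sum of every array equal to 0.
record MRS* {c ℓ} (G : AddStr c ℓ) (x y z : ℕ) : Set (c ⊔ ℓ) where
  open AddStr G
  field
    array     : Fin z → Fin x → Fin y → Carrier
    bijective : Bijective {A = Fin z × Fin x × Fin y} _≡_ _≈_
                  (λ { (k , i , j) → array k i j })
    rowSums   : ∀ k i → sumF G (λ j → array k i j) ≈ 0#
    colSums   : ∀ k j → sumF G (λ i → array k i j) ≈ 0#

-- Natural-number division with the (never used) convention n div 0 = 0.
_div_ : ℕ → ℕ → ℕ
n div zero  = 0
n div suc d = n / suc d

G₁ : ∀ {c ℓ} → ℕ → AbelianGroup c ℓ → ℕ → ℕ → AddStr c ℓ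
G₁ p H α β = Z p ⊕ fromAbelianGroup H ⊕ Z (2 ^ (α ∸ 1)) ⊕ Z (2 ^ (β ∸ 1))

G₂ : ∀ {c ℓ} → ℕ → AbelianGroup c ℓ → ℕ → ℕ → AddStr c ℓ
G₂ p H α β = Z p ⊕ fromAbelianGroup H ⊕ Z (2 ^ α) ⊕ Z (2 ^ β)

module Submission where

-- Let π : ℤ_{2^α} ⊕ ℤ_{2^β} → ℤ_{2^(α-1)} ⊕ ℤ_{2^(β-1)} be the reduction map; its kernel K is a
-- Klein four-group. Lift the last component of every entry of a given array along a section of
-- π: the row and column sums of the lifted array then lie in K, and since K has exponent 2
-- they can be repaired by adding a matrix over K with the same margins. Every repaired array
-- gives four arrays, one for each t ∈ K ≅ 𝔽₄: shift row i by ω^{c(i)} t, where the row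
-- classes are c = 0, 1, 2, 0, 0, …, 0. The shifts cancel along a row because it has four
-- entries, and along a column because 1 + ω + ω² = 0 and p − 3 is even. Since the correction
-- and the shift lie in K, every element of G₂ is hit exactly once.

open import Level using (_⊔_; 0ℓ)
open import Data.Nat using (ℕ; zero; suc; _+_; _*_; _∸_; _^_; NonZero)
open import Data.Nat.Properties using (+-suc; m^n≢0)
open import Data.Nat.DivMod using (m*n/n≡m)
open import Data.Nat.Divisibility using (_∣_; divides; ∣-refl; ∣m∣n⇒∣m+n)
open import Data.Nat.Primality using (Prime; ¬prime[1]; prime⇒nonZero)
open import Data.Nat.Solver using (module +-*-Solver)
open import Data.Fin using (Fin; zero; suc; remQuot; combine)
open import Data.Fin.Patterns using (0F; 1F; 2F; 3F)
open import Data.Fin.Properties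
  using (all?; any?; *↔×; remQuot-combine; cantor-schröder-bernstein)
  renaming (_≟_ to _≟ᶠ_)
open import Data.Product using (_×_; _,_; proj₁; proj₂; ∃-syntax; map)
open import Data.Product.Properties using (≡-dec)
open import Data.Product.Relation.Binary.Pointwise.NonDependent using (Pointwise; ×-isEquivalence)
open import Data.Product.Function.NonDependent.Propositional using (_×-↔_)
open import Data.Sum using (_⊎_; inj₁; inj₂)
open import Data.Empty using (⊥-elim)
open import Function using (_∘_; _$_; id)
open import Function.Bundles using (_↔_; Inverse; Bijection)
open import Function.Definitions using (Bijective; Injective; Surjective)
open import Function.Properties.Inverse using (Inverse⇒Bijection)
open import Function.Construct.Composition using (_↔-∘_) renaming (bijective to ∘-bijective)
open import Function.Construct.Identity using (↔-id)
open import Algebra.Bundles using (AbelianGroup; CommutativeMonoid)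
open import Algebra.Structures using (IsCommutativeMonoid)
open import Algebra.Definitions using (LeftCancellative)
open import Relation.Binary.Core using (Rel)
open import Relation.Binary.Structures using (IsEquivalence)
open import Relation.Binary.PropositionalEquality
  using (_≡_; refl; sym; trans; cong; cong₂; subst; isEquivalence; module ≡-Reasoning)
open import Relation.Nullary using (¬_; Dec)
open import Relation.Nullary.Decidable using (True; toWitness; map′; _×-dec_; _→-dec_)
open import Relation.Unary using (Pred)
open import Defs

module Torsion₂Sums {c ℓ} (M : CommutativeMonoid c ℓ) where
  open CommutativeMonoid M renaming (refl to ≈-refl; trans to ≈-trans)
  open import Algebra.Properties.CommutativeMonoid.Sum M
  open import Algebra.Properties.Monoid.Mult monoid using (×-homo-+) renaming (_×_ to _·_)
  open import Algebra.Solver.CommutativeMonoid M using (solve; _⊜_) renaming (_⊕_ to _⊞_)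
  open import Relation.Binary.Reasoning.Setoid setoid

  ∑-closed : ∀ {q} (P : Pred Carrier q) → P ε → (∀ {x y} → P x → P y → P (x ∙ y)) →
             ∀ {n} (f : Fin n → Carrier) → (∀ i → P (f i)) → P (sum f)
  ∑-closed P Pε P∙ {zero}  f Pf = Pε
  ∑-closed P Pε P∙ {suc n} f Pf = P∙ (Pf 0F) (∑-closed P Pε P∙ (f ∘ suc) (Pf ∘ suc))

  Torsion₂ : Pred Carrier ℓ
  Torsion₂ x = x ∙ x ≈ ε

  ε-torsion₂ : Torsion₂ ε
  ε-torsion₂ = identityˡ ε

  ∙-torsion₂ : ∀ {x y} → Torsion₂ x → Torsion₂ y → Torsion₂ (x ∙ y)
  ∙-torsion₂ {x} {y} x+x≈ε y+y≈ε = begin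
    (x ∙ y) ∙ (x ∙ y)  ≈⟨ solve 2 (λ x y → (x ⊞ y) ⊞ (x ⊞ y) ⊜ (x ⊞ x) ⊞ (y ⊞ y)) ≈-refl x y ⟩
    (x ∙ x) ∙ (y ∙ y)  ≈⟨ ∙-cong x+x≈ε y+y≈ε ⟩
    ε ∙ ε              ≈⟨ ε-torsion₂ ⟩
    ε                  ∎

  ∑-torsion₂ : ∀ {n} (f : Fin n → Carrier) → (∀ i → Torsion₂ (f i)) → Torsion₂ (sum f)
  ∑-torsion₂ = ∑-closed Torsion₂ ε-torsion₂ ∙-torsion₂

  ×-torsion₂ : ∀ n {x} → Torsion₂ x → Torsion₂ (n · x)
  ×-torsion₂ zero    _     = ε-torsion₂
  ×-torsion₂ (suc n) x+x≈ε = ∙-torsion₂ x+x≈ε (×-torsion₂ n x+x≈ε)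

  torsion₂-cancelˡ : ∀ {x} y → Torsion₂ x → x ∙ (x ∙ y) ≈ y
  torsion₂-cancelˡ {x} y x+x≈ε = begin
    x ∙ (x ∙ y)  ≈⟨ assoc x x y ⟨
    (x ∙ x) ∙ y  ≈⟨ ∙-congʳ x+x≈ε ⟩
    ε ∙ y        ≈⟨ identityˡ y ⟩
    y            ∎

  torsion₂-cancelʳ : ∀ {x} y → Torsion₂ x → (y ∙ x) ∙ x ≈ y
  torsion₂-cancelʳ {x} y x+x≈ε = begin
    (y ∙ x) ∙ x  ≈⟨ assoc y x x ⟩
    y ∙ (x ∙ x)  ≈⟨ ∙-congˡ x+x≈ε ⟩
    y ∙ ε        ≈⟨ identityʳ y ⟩
    y            ∎

  ∑-replicate-double : ∀ m {x} → Torsion₂ x → ∑[ i < m + m ] x ≈ ε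
  ∑-replicate-double m {x} x+x≈ε = begin
    ∑[ i < m + m ] x  ≈⟨ sum-replicate (m + m) ⟩
    (m + m) · x       ≈⟨ ×-homo-+ x m m ⟩
    m · x ∙ m · x     ≈⟨ ×-torsion₂ m x+x≈ε ⟩
    ε                 ∎

  ∑-cancel-torsion₂ : ∀ {n a} {f g h : Fin n → Carrier} → sum f ≈ a → sum g ≈ a → sum h ≈ ε →
                      Torsion₂ a → ∑[ i < n ] (f i ∙ (g i ∙ h i)) ≈ ε
  ∑-cancel-torsion₂ {a = a} {f} {g} {h} ∑f≈a ∑g≈a ∑h≈ε a+a≈ε = begin
    ∑[ i < _ ] (f i ∙ (g i ∙ h i))  ≈⟨ ∑-distrib-+ f _ ⟩
    sum f ∙ sum (λ i → g i ∙ h i)   ≈⟨ ∙-congˡ (∑-distrib-+ g h) ⟩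
    sum f ∙ (sum g ∙ sum h)         ≈⟨ ∙-cong ∑f≈a (∙-cong ∑g≈a ∑h≈ε) ⟩
    a ∙ (a ∙ ε)                     ≈⟨ ∙-congˡ (identityʳ a) ⟩
    a ∙ a                           ≈⟨ a+a≈ε ⟩
    ε                               ∎

  withMargins : ∀ {m n} → (Fin (suc m) → Carrier) → (Fin (suc n) → Carrier) →
                Fin (suc m) → Fin (suc n) → Carrier
  withMargins r c 0F      0F      = r 0F ∙ sum (c ∘ suc)
  withMargins r c 0F      (suc j) = c (suc j)
  withMargins r c (suc i) 0F      = r (suc i)
  withMargins r c (suc i) (suc j) = ε

  module _ {m n} {r : Fin (suc m) → Carrier} {c : Fin (suc n) → Carrier}
           (c-torsion₂ : ∀ j → Torsion₂ (c j)) where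

    withMargins-rowSum : ∀ i → sum (withMargins r c i) ≈ r i
    withMargins-rowSum 0F      = torsion₂-cancelʳ (r 0F) (∑-torsion₂ (c ∘ suc) (c-torsion₂ ∘ suc))
    withMargins-rowSum (suc i) = ≈-trans (∙-congˡ (sum-replicate-zero n)) (identityʳ (r (suc i)))

    withMargins-colSum : sum r ≈ sum c → ∀ j → ∑[ i < suc m ] withMargins r c i j ≈ c j
    withMargins-colSum ∑r≈∑c 0F = begin
      (r 0F ∙ C′) ∙ R′  ≈⟨ solve 3 (λ a b d → (a ⊞ d) ⊞ b ⊜ (a ⊞ b) ⊞ d) ≈-refl (r 0F) R′ C′ ⟩
      sum r ∙ C′        ≈⟨ ∙-congʳ ∑r≈∑c ⟩
      sum c ∙ C′        ≈⟨ torsion₂-cancelʳ (c 0F) (∑-torsion₂ (c ∘ suc) (c-torsion₂ ∘ suc)) ⟩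
      c 0F              ∎
      where
      C′ : Carrier
      C′ = sum (c ∘ suc)
      R′ : Carrier
      R′ = sum (r ∘ suc)
    withMargins-colSum _ (suc j) = ≈-trans (∙-congˡ (sum-replicate-zero m)) (identityʳ (c (suc j)))

  withMargins-closed : ∀ {q m n} (P : Pred Carrier q) → P ε → (∀ {x y} → P x → P y → P (x ∙ y)) →
                       {r : Fin (suc m) → Carrier} {c : Fin (suc n) → Carrier} →
                       (∀ i → P (r i)) → (∀ j → P (c j)) → ∀ i j → P (withMargins r c i j)
  withMargins-closed P Pε P∙ Pr Pc 0F      0F      = P∙ (Pr 0F) (∑-closed P Pε P∙ _ (Pc ∘ suc))
  withMargins-closed P Pε P∙ Pr Pc 0F      (suc j) = Pc (suc j)
  withMargins-closed P Pε P∙ Pr Pc (suc i) 0F      = Pr (suc i)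
  withMargins-closed P Pε P∙ Pr Pc (suc i) (suc j) = Pε

×-bijective : ∀ {i j a b ℓ₁ ℓ₂} {I : Set i} {J : Set j} {A : Set a} {B : Set b}
              {_≈₁_ : Rel A ℓ₁} {_≈₂_ : Rel B ℓ₂} {f : I → A} {g : J → B} →
              Bijective _≡_ _≈₁_ f → Bijective _≡_ _≈₂_ g → Bijective _≡_ (Pointwise _≈₁_ _≈₂_) (map f g)
×-bijective (f-injective , f-surjective) (g-injective , g-surjective) =
  (λ (fx≈fx′ , gy≈gy′) → cong₂ _,_ (f-injective fx≈fx′) (g-injective gy≈gy′)) ,
  λ (a , b) → (proj₁ (f-surjective a) , proj₁ (g-surjective b)) ,
              λ { refl → proj₂ (f-surjective a) refl , proj₂ (g-surjective b) refl }

↔-bijective : ∀ {a b} {A : Set a} {B : Set b} (A↔B : A ↔ B) → Bijective _≡_ _≡_ (Inverse.to A↔B)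
↔-bijective A↔B = Bijection.bijective (Inverse⇒Bijection A↔B)

record Enumeration {c ℓ} (G : AddStr c ℓ) (n : ℕ) : Set (c ⊔ ℓ) where
  constructor enumeration
  field
    enum      : Fin n → AddStr.Carrier G
    bijective : Bijective _≡_ (AddStr._≈_ G) enum

HasOrder⇒Enumeration : ∀ {c ℓ} (H : AbelianGroup c ℓ) {n} →
                       HasOrder H n → Enumeration (fromAbelianGroup H) n
HasOrder⇒Enumeration H (f , f-bijective) = enumeration f f-bijective

enumeration-size-unique : ∀ {c ℓ} {G : AddStr c ℓ} {m n} → IsEquivalence (AddStr._≈_ G) →
                          Enumeration G m → Enumeration G n → m ≡ n
enumeration-size-unique {G = G} ≈-isEquivalence (enumeration f f-bijective) (enumeration g g-bijective) =
  cantor-schröder-bernstein (inverse∘injective g-bijective (proj₁ f-bijective))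
                            (inverse∘injective f-bijective (proj₁ g-bijective))
  where
  open AddStr G using (Carrier; _≈_)
  open IsEquivalence ≈-isEquivalence using (reflexive) renaming (sym to ≈-sym; trans to ≈-trans)
  inverse∘injective : ∀ {a b} {u : Fin a → Carrier} {v : Fin b → Carrier}
                      (u-bijective : Bijective _≡_ _≈_ u) →
                      Injective _≡_ _≈_ v → Injective _≡_ _≡_ (λ i → proj₁ (proj₂ u-bijective (v i)))
  inverse∘injective {u = u} {v} (_ , u-surjective) v-injective {i} {j} u⁻¹vi≡u⁻¹vj =
    v-injective (≈-trans (≈-sym (u∘u⁻¹ (v i))) (≈-trans (reflexive (cong u u⁻¹vi≡u⁻¹vj)) (u∘u⁻¹ (v j))))
    where
    u∘u⁻¹ : ∀ y → u (proj₁ (u-surjective y)) ≈ y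
    u∘u⁻¹ y = proj₂ (u-surjective y) refl

Z-enumeration : ∀ v → {{NonZero v}} → Enumeration (Z v) v
Z-enumeration (suc v) = enumeration id (id , λ y → y , id)

Z-isEquivalence : ∀ v → IsEquivalence (AddStr._≈_ (Z v))
Z-isEquivalence zero    = isEquivalence
Z-isEquivalence (suc v) = isEquivalence

⊕-enumeration : ∀ {a b c d} {A : AddStr a b} {B : AddStr c d} {m n} →
                Enumeration A m → Enumeration B n → Enumeration (A ⊕ B) (m * n)
⊕-enumeration {A = A} {B} (enumeration f f-bijective) (enumeration g g-bijective) =
  enumeration (map f g ∘ remQuot _) $
  ∘-bijective _≡_ _≡_ (AddStr._≈_ (A ⊕ B)) (↔-bijective *↔×)
    (×-bijective {_≈₁_ = AddStr._≈_ A} {AddStr._≈_ B} {f = f} {g} f-bijective g-bijective)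

MRS*-enumeration : ∀ {c ℓ} {G : AddStr c ℓ} {x y z} → MRS* G x y z → Enumeration G (z * (x * y))
MRS*-enumeration {G = G} M =
  enumeration _ $
  ∘-bijective _≡_ _≡_ (AddStr._≈_ G) (↔-bijective ((↔-id _ ×-↔ *↔×) ↔-∘ *↔×)) (MRS*.bijective M)

G₁-enumeration : ∀ {c ℓ} p {{_ : NonZero p}} (H : AbelianGroup c ℓ) {n} → HasOrder H n → ∀ α β →
                 Enumeration (G₁ p H α β) (p * (n * (2 ^ (α ∸ 1) * 2 ^ (β ∸ 1))))
G₁-enumeration p H H-order α β =
  ⊕-enumeration (Z-enumeration p) $ ⊕-enumeration (HasOrder⇒Enumeration H H-order) $
  ⊕-enumeration (Z-enumeration (2 ^ (α ∸ 1)) {{m^n≢0 2 (α ∸ 1)}})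
                (Z-enumeration (2 ^ (β ∸ 1)) {{m^n≢0 2 (β ∸ 1)}})

G₁-isEquivalence : ∀ {c ℓ} p (H : AbelianGroup c ℓ) α β → IsEquivalence (AddStr._≈_ (G₁ p H α β))
G₁-isEquivalence p H α β =
  ×-isEquivalence (Z-isEquivalence p) $ ×-isEquivalence (AbelianGroup.isEquivalence H) $
  ×-isEquivalence (Z-isEquivalence (2 ^ (α ∸ 1))) (Z-isEquivalence (2 ^ (β ∸ 1)))

sumF-⊕ : ∀ {a b c d} (A : AddStr a b) (B : AddStr c d) {n} (f : Fin n → AddStr.Carrier (A ⊕ B)) →
         sumF (A ⊕ B) f ≡ (sumF A (proj₁ ∘ f) , sumF B (proj₂ ∘ f))
sumF-⊕ A B {zero}  f = refl
sumF-⊕ A B {suc n} f rewrite sumF-⊕ A B (f ∘ suc) = refl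

record KleinExtension {c₁ ℓ₁ c₂ ℓ₂} (E₁ : AddStr c₁ ℓ₁) (E₂ : AddStr c₂ ℓ₂) :
                      Set (c₁ ⊔ ℓ₁ ⊔ c₂ ⊔ ℓ₂) where
  open AddStr E₁ renaming (Carrier to C₁; _≈_ to _≈₁_; _∙_ to _∙₁_; 0# to 0₁)
  open AddStr E₂ renaming (Carrier to C₂; _≈_ to _≈₂_; _∙_ to _∙₂_; 0# to 0₂)
  field
    ≈₁⇒≡ : ∀ {x y} → x ≈₁ y → x ≡ y
    ≡⇒≈₁ : ∀ {x y} → x ≡ y → x ≈₁ y
    ≈₂⇒≡ : ∀ {x y} → x ≈₂ y → x ≡ y
    ≡⇒≈₂ : ∀ {x y} → x ≡ y → x ≈₂ y
    ∙₁-identityʳ        : ∀ a → a ∙₁ 0₁ ≡ a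
    isCommutativeMonoid : IsCommutativeMonoid _≡_ _∙₂_ 0₂
    ∙₂-cancelˡ          : LeftCancellative _≡_ _∙₂_
    π      : C₂ → C₁
    π-∙    : ∀ x y → π (x ∙₂ y) ≡ π x ∙₁ π y
    π-ε    : π 0₂ ≡ 0₁
    lift   : C₁ → C₂
    π∘lift : ∀ a → π (lift a) ≡ a
    lift∘π : ∀ x → ∃[ k ] π k ≡ 0₁ × lift (π x) ∙₂ k ≡ x
    ker-torsion₂ : ∀ k → π k ≡ 0₁ → k ∙₂ k ≡ 0₂
    ρ            : Fin 3 → Fin 4 → C₂
    ρ-ker        : ∀ c t → π (ρ c t) ≡ 0₁
    ρ-injective  : ∀ c t t′ → ρ c t ≡ ρ c t′ → t ≡ t′
    ρ-surjective : ∀ c k → π k ≡ 0₁ → ∃[ t ] ρ c t ≡ k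
    ρ-sum        : ∀ t → ρ 0F t ∙₂ (ρ 1F t ∙₂ ρ 2F t) ≡ 0₂

module Lifting {cx ℓx cy ℓy c₁ ℓ₁ c₂ ℓ₂} (X : AddStr cx ℓx) (Y : AddStr cy ℓy)
               {E₁ : AddStr c₁ ℓ₁} {E₂ : AddStr c₂ ℓ₂} (K : KleinExtension E₁ E₂) where
  open KleinExtension K
  open AddStr E₁ using () renaming (Carrier to C₁; _∙_ to _∙₁_; 0# to 0₁)

  E₂-monoid : CommutativeMonoid c₂ c₂
  E₂-monoid = record { isCommutativeMonoid = isCommutativeMonoid }

  open CommutativeMonoid E₂-monoid using (Carrier; _∙_; ε; identityʳ)
  open import Algebra.Properties.CommutativeMonoid.Sum E₂-monoid using (sum; sum-syntax; ∑-comm)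
  open Torsion₂Sums E₂-monoid

  G₁′ : AddStr (cx ⊔ cy ⊔ c₁) (ℓx ⊔ ℓy ⊔ ℓ₁)
  G₁′ = X ⊕ Y ⊕ E₁

  G₂′ : AddStr (cx ⊔ cy ⊔ c₂) (ℓx ⊔ ℓy ⊔ ℓ₂)
  G₂′ = X ⊕ Y ⊕ E₂
  open AddStr G₁′ using () renaming (_≈_ to _≈G₁′_; 0# to 0G₁′)
  open AddStr G₂′ using () renaming (_≈_ to _≈G₂′_; 0# to 0G₂′)

  Ker : Pred Carrier c₁
  Ker k = π k ≡ 0₁

  ker-∙ : ∀ {x y} → Ker x → Ker y → Ker (x ∙ y)
  ker-∙ {x} {y} πx≡0 πy≡0 = trans (π-∙ x y) (trans (cong₂ _∙₁_ πx≡0 πy≡0) (∙₁-identityʳ 0₁))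

  π-lift-∙ker : ∀ a {k} → Ker k → π (lift a ∙ k) ≡ a
  π-lift-∙ker a {k} πk≡0 =
    trans (π-∙ (lift a) k) (trans (cong (π (lift a) ∙₁_) πk≡0) (trans (∙₁-identityʳ _) (π∘lift a)))

  π-∑lift : ∀ {n} (a : Fin n → C₁) → π (sum (lift ∘ a)) ≡ sumF E₁ a
  π-∑lift {zero}  a = π-ε
  π-∑lift {suc n} a = trans (π-∙ _ _) (cong₂ _∙₁_ (π∘lift (a 0F)) (π-∑lift (a ∘ suc)))

  sumF≡sum : ∀ {n} (f : Fin n → Carrier) → sumF E₂ f ≡ sum f
  sumF≡sum {zero}  f = refl
  sumF≡sum {suc n} f = cong (f 0F ∙_) (sumF≡sum (f ∘ suc))

  sumF-⊕₃ : ∀ {c ℓ} {E : AddStr c ℓ} {n} (f : Fin n → AddStr.Carrier (X ⊕ Y ⊕ E)) →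
            sumF (X ⊕ Y ⊕ E) f ≡
            (sumF X (proj₁ ∘ f) , sumF Y (proj₁ ∘ proj₂ ∘ f) , sumF E (proj₂ ∘ proj₂ ∘ f))
  sumF-⊕₃ {E = E} f = trans (sumF-⊕ X (Y ⊕ E) f) (cong (sumF X (proj₁ ∘ f) ,_) (sumF-⊕ Y E (proj₂ ∘ f)))

  ∑E₁≡0 : ∀ {n} (f : Fin n → AddStr.Carrier G₁′) → sumF G₁′ f ≈G₁′ 0G₁′ → sumF E₁ (proj₂ ∘ proj₂ ∘ f) ≡ 0₁
  ∑E₁≡0 f ∑f≈0 = ≈₁⇒≡ (proj₂ (proj₂ (subst (_≈G₁′ 0G₁′) (sumF-⊕₃ f) ∑f≈0)))

  replaceE : AddStr.Carrier G₁′ → Carrier → AddStr.Carrier G₂′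
  replaceE (x , y , _) e = x , y , e

  replaceE-sum : ∀ {n} (f : Fin n → AddStr.Carrier G₁′) (h : Fin n → Carrier) →
                 sumF G₁′ f ≈G₁′ 0G₁′ → sum h ≡ ε → sumF G₂′ (λ i → replaceE (f i) (h i)) ≈G₂′ 0G₂′
  replaceE-sum f h ∑f≈0 ∑h≡0
    with ∑x≈0 , ∑y≈0 , _ ← subst (_≈G₁′ 0G₁′) (sumF-⊕₃ f) ∑f≈0
    = subst (_≈G₂′ 0G₂′) (sym (sumF-⊕₃ (λ i → replaceE (f i) (h i))))
        (∑x≈0 , ∑y≈0 , ≡⇒≈₂ (trans (sumF≡sum h) ∑h≡0))

  module Construction {m z : ℕ} (M : MRS* G₁′ (3 + (m + m)) 4 z) where
    open MRS* M
    open ≡-Reasoning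

    p : ℕ
    p = 3 + (m + m)

    e : Fin z → Fin p → Fin 4 → C₁
    e k i j = proj₂ (proj₂ (array k i j))

    lifted : Fin z → Fin p → Fin 4 → Carrier
    lifted k i j = lift (e k i j)

    r : Fin z → Fin p → Carrier
    r k i = sum (lifted k i)

    c : Fin z → Fin 4 → Carrier
    c k j = ∑[ i < p ] lifted k i j

    r-ker : ∀ k i → Ker (r k i)
    r-ker k i = trans (π-∑lift (e k i)) (∑E₁≡0 (array k i) (rowSums k i))

    c-ker : ∀ k j → Ker (c k j)
    c-ker k j = trans (π-∑lift (λ i → e k i j)) (∑E₁≡0 (λ i → array k i j) (colSums k j))

    D : Fin z → Fin p → Fin 4 → Carrier
    D k = withMargins (r k) (c k)

    D-ker : ∀ k i j → Ker (D k i j)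
    D-ker k = withMargins-closed Ker π-ε ker-∙ (r-ker k) (c-ker k)

    rowClass : Fin p → Fin 3
    rowClass 0F                  = 0F
    rowClass 1F                  = 1F
    rowClass 2F                  = 2F
    rowClass (suc (suc (suc _))) = 0F

    ρ-torsion₂ : ∀ c t → Torsion₂ (ρ c t)
    ρ-torsion₂ c t = ker-torsion₂ _ (ρ-ker c t)

    ∑-shift-column : ∀ t → ∑[ i < p ] ρ (rowClass i) t ≡ ε
    ∑-shift-column t = begin
      ρ 0F t ∙ (ρ 1F t ∙ (ρ 2F t ∙ ∑[ i < m + m ] ρ 0F t))
        ≡⟨ cong (λ s → ρ 0F t ∙ (ρ 1F t ∙ (ρ 2F t ∙ s))) (∑-replicate-double m (ρ-torsion₂ 0F t)) ⟩
      ρ 0F t ∙ (ρ 1F t ∙ (ρ 2F t ∙ ε))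
        ≡⟨ cong (λ s → ρ 0F t ∙ (ρ 1F t ∙ s)) (identityʳ (ρ 2F t)) ⟩
      ρ 0F t ∙ (ρ 1F t ∙ ρ 2F t)
        ≡⟨ ρ-sum t ⟩
      ε ∎

    entry : Fin z → Fin 4 → Fin p → Fin 4 → Carrier
    entry k t i j = lifted k i j ∙ (D k i j ∙ ρ (rowClass i) t)

    c-torsion₂ : ∀ k j → Torsion₂ (c k j)
    c-torsion₂ k j = ker-torsion₂ _ (c-ker k j)

    entry-rowSum : ∀ k t i → sum (entry k t i) ≡ ε
    entry-rowSum k t i =
      ∑-cancel-torsion₂ {f = lifted k i} {g = D k i} {h = λ _ → ρ (rowClass i) t}
        refl (withMargins-rowSum (c-torsion₂ k) i)
        (∑-replicate-double 2 (ρ-torsion₂ (rowClass i) t)) (ker-torsion₂ _ (r-ker k i))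

    entry-colSum : ∀ k t j → ∑[ i < p ] entry k t i j ≡ ε
    entry-colSum k t j =
      ∑-cancel-torsion₂ {f = λ i → lifted k i j} {g = λ i → D k i j} {h = λ i → ρ (rowClass i) t}
        refl (withMargins-colSum (c-torsion₂ k) (∑-comm (lifted k)) j)
        (∑-shift-column t) (c-torsion₂ k j)

    π-entry : ∀ k t i j → π (entry k t i j) ≡ e k i j
    π-entry k t i j = π-lift-∙ker (e k i j) (ker-∙ (D-ker k i j) (ρ-ker (rowClass i) t))

    copy : Fin z × Fin 4 → Fin p → Fin 4 → AddStr.Carrier G₂′
    copy (k , t) i j = replaceE (array k i j) (entry k t i j)

    array₂ : Fin (z * 4) → Fin p → Fin 4 → AddStr.Carrier G₂′
    array₂ = copy ∘ remQuot 4

    cell-injective : ∀ {k t i j k′ t′ i′ j′} → copy (k , t) i j ≈G₂′ copy (k′ , t′) i′ j′ →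
                     (k , i , j) ≡ (k′ , i′ , j′)
    cell-injective {k} {t} {i} {j} {k′} {t′} {i′} {j′} (x≈x′ , y≈y′ , entry≈entry′) =
      proj₁ bijective (x≈x′ , y≈y′ , ≡⇒≈₁ e≡e′)
      where
      e≡e′ : e k i j ≡ e k′ i′ j′
      e≡e′ = trans (sym (π-entry k t i j)) (trans (cong π (≈₂⇒≡ entry≈entry′)) (π-entry k′ t′ i′ j′))

    copy-injective : ∀ {k t i j k′ t′ i′ j′} → copy (k , t) i j ≈G₂′ copy (k′ , t′) i′ j′ →
                     ((k , t) , i , j) ≡ ((k′ , t′) , i′ , j′)
    copy-injective {k} {t} {i} {j} copy≈copy′ with refl ← cell-injective copy≈copy′ =
      cong (λ t → (k , t) , i , j)
        (ρ-injective _ _ _ (∙₂-cancelˡ _ _ _ (∙₂-cancelˡ _ _ _ (≈₂⇒≡ (proj₂ (proj₂ copy≈copy′))))))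

    cells₂ : Fin (z * 4) × Fin p × Fin 4 → AddStr.Carrier G₂′
    cells₂ (kt , i , j) = array₂ kt i j

    array₂-injective : Injective _≡_ _≈G₂′_ cells₂
    array₂-injective {kt , i , j} {kt′ , i′ , j′} array₂≈array₂′ =
      cong₂ _,_ (proj₁ (↔-bijective *↔×) (cong proj₁ same)) (cong proj₂ same)
      where
      same : (remQuot 4 kt , i , j) ≡ (remQuot 4 kt′ , i′ , j′)
      same = copy-injective array₂≈array₂′

    copy-surjective : ∀ y → ∃[ q ] ∃[ i ] ∃[ j ] copy q i j ≈G₂′ y
    copy-surjective (x , y , e′)
      with (k , i , j) , cell≈ ← proj₂ bijective (x , y , π e′)
         | κ , κ-ker , lift-π+κ≡e′ ← lift∘π e′
      with x≈ , y≈ , e≈ ← cell≈ refl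
         | t , ρ≡D+κ ← ρ-surjective (rowClass i) (D k i j ∙ κ) (ker-∙ (D-ker k i j) κ-ker)
      = (k , t) , i , j , x≈ , y≈ , ≡⇒≈₂ (begin
        lift (e k i j) ∙ (D k i j ∙ ρ (rowClass i) t)
          ≡⟨ cong₂ (λ a s → lift a ∙ (D k i j ∙ s)) (≈₁⇒≡ e≈) ρ≡D+κ ⟩
        lift (π e′) ∙ (D k i j ∙ (D k i j ∙ κ))
          ≡⟨ cong (lift (π e′) ∙_) (torsion₂-cancelˡ κ (ker-torsion₂ _ (D-ker k i j))) ⟩
        lift (π e′) ∙ κ
          ≡⟨ lift-π+κ≡e′ ⟩
        e′ ∎)

    array₂-surjective : Surjective _≡_ _≈G₂′_ cells₂
    array₂-surjective y with (k , t) , i , j , copy≈y ← copy-surjective y =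
      (combine k t , i , j) ,
      λ { refl → subst (λ q → copy q i j ≈G₂′ y) (sym (remQuot-combine k t)) copy≈y }

    liftedMRS* : MRS* G₂′ p 4 (z * 4)
    liftedMRS* = record
      { array     = array₂
      ; bijective = array₂-injective , array₂-surjective
      ; rowSums   = λ kt i → let (k , t) = remQuot 4 kt in
                      replaceE-sum (array k i) (entry k t i) (rowSums k i) (entry-rowSum k t i)
      ; colSums   = λ kt j → let (k , t) = remQuot 4 kt in
                      replaceE-sum (λ i → array k i j) (λ i → entry k t i j)
                                   (colSums k j) (entry-colSum k t j)
      }

  liftMRS* : ∀ {p z} → ∃[ m ] p ≡ 3 + (m + m) → MRS* G₁′ p 4 z → MRS* G₂′ p 4 (z * 4)
  liftMRS* (m , refl) M = Construction.liftedMRS* {m} M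

-- Data for ℤ_{a₂+1} → ℤ_{a₁+1}; nothing is assumed of it, as KleinFour verifies the resulting
-- extension by evaluation.
record Halving (a₁ a₂ : ℕ) : Set where
  field
    reduce  : Fin (suc a₂) → Fin (suc a₁)
    section : Fin (suc a₁) → Fin (suc a₂)
    half    : Fin (suc a₂)

halving₂ : Halving 0 1
halving₂ = record { reduce = λ _ → 0F ; section = λ _ → 0F ; half = 1F }

halving₄ : Halving 1 3
halving₄ = record { reduce = mod2 ; section = λ { 0F → 0F ; 1F → 1F } ; half = 2F }
  where
  mod2 : Fin 4 → Fin 2
  mod2 0F = 0F
  mod2 1F = 1F
  mod2 2F = 0F
  mod2 3F = 1F

all-pairs? : ∀ {m n q} {P : Pred (Fin m × Fin n) q} → (∀ x → Dec (P x)) → Dec (∀ x → P x)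
all-pairs? P? = map′ (λ ∀P x,y → ∀P (proj₁ x,y) (proj₂ x,y)) (λ ∀P x y → ∀P (x , y))
                     (all? λ x → all? λ y → P? (x , y))

any-pair? : ∀ {m n q} {P : Pred (Fin m × Fin n) q} → (∀ x → Dec (P x)) → Dec (∃[ x ] P x)
any-pair? P? = map′ (λ (x , y , Pxy) → (x , y) , Pxy) (λ ((x , y) , Pxy) → x , y , Pxy)
                    (any? λ x → any? λ y → P? (x , y))

module KleinFour {a₁ a₂ b₁ b₂} (A : Halving a₁ a₂) (B : Halving b₁ b₂) where
  open Halving

  E₁ : AddStr 0ℓ 0ℓ
  E₁ = ZmodSuc a₁ ⊕ ZmodSuc b₁

  E₂ : AddStr 0ℓ 0ℓ
  E₂ = ZmodSuc a₂ ⊕ ZmodSuc b₂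

  open AddStr E₁ using () renaming (Carrier to C₁; _∙_ to _∙₁_; 0# to 0₁)
  open AddStr E₂ using (_∙_; 0#) renaming (Carrier to C₂)

  infix 4 _≟₁_ _≟₂_
  _≟₁_ : (x y : C₁) → Dec (x ≡ y)
  _≟₁_ = ≡-dec _≟ᶠ_ _≟ᶠ_

  _≟₂_ : (x y : C₂) → Dec (x ≡ y)
  _≟₂_ = ≡-dec _≟ᶠ_ _≟ᶠ_

  π : C₂ → C₁
  π (x , y) = reduce A x , reduce B y

  lift : C₁ → C₂
  lift (x , y) = section A x , section B y

  -- Fin 4 encodes 𝔽₄ = {0, 1, ω, ω²} in this order: κ is additive and ω* is multiplication
  -- by ω, so ρ c t = κ (ω^c t) and ρ-sum is the identity 1 + ω + ω² = 0.
  κ : Fin 4 → C₂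
  κ 0F = 0F , 0F
  κ 1F = half A , 0F
  κ 2F = 0F , half B
  κ 3F = half A , half B

  ω* : Fin 4 → Fin 4
  ω* 0F = 0F
  ω* 1F = 2F
  ω* 2F = 3F
  ω* 3F = 1F

  ρ : Fin 3 → Fin 4 → C₂
  ρ 0F = κ
  ρ 1F = κ ∘ ω*
  ρ 2F = κ ∘ ω* ∘ ω*

  kleinExtension :
    {_ : True (all-pairs? (λ x → all-pairs? λ y → all-pairs? λ z → (x ∙ y) ∙ z ≟₂ x ∙ (y ∙ z))
       ×-dec all-pairs? (λ x → all-pairs? λ y → x ∙ y ≟₂ y ∙ x)
       ×-dec all-pairs? (λ x → 0# ∙ x ≟₂ x)
       ×-dec all-pairs? (λ x → x ∙ 0# ≟₂ x)
       ×-dec all-pairs? (λ x → all-pairs? λ y → all-pairs? λ z → (x ∙ y ≟₂ x ∙ z) →-dec (y ≟₂ z))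
       ×-dec all-pairs? (λ a → a ∙₁ 0₁ ≟₁ a)
       ×-dec all-pairs? (λ x → all-pairs? λ y → π (x ∙ y) ≟₁ π x ∙₁ π y)
       ×-dec (π 0# ≟₁ 0₁)
       ×-dec all-pairs? (λ a → π (lift a) ≟₁ a)
       ×-dec all-pairs? (λ x → any-pair? λ k → (π k ≟₁ 0₁) ×-dec (lift (π x) ∙ k ≟₂ x))
       ×-dec all-pairs? (λ k → (π k ≟₁ 0₁) →-dec (k ∙ k ≟₂ 0#))
       ×-dec all? (λ c → all? λ t → π (ρ c t) ≟₁ 0₁)
       ×-dec all? (λ c → all? λ t → all? λ t′ → (ρ c t ≟₂ ρ c t′) →-dec (t ≟ᶠ t′))
       ×-dec all? (λ c → all-pairs? λ k → (π k ≟₁ 0₁) →-dec any? λ t → ρ c t ≟₂ k)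
       ×-dec all? (λ t → ρ 0F t ∙ (ρ 1F t ∙ ρ 2F t) ≟₂ 0#))} →
    KleinExtension E₁ E₂
  kleinExtension {checks} =
    let (assoc , comm , identityˡ , identityʳ , cancelˡ , ∙₁-identityʳ , π-∙ , π-ε , π∘lift , lift∘π ,
         ker-torsion₂ , ρ-ker , ρ-injective , ρ-surjective , ρ-sum) = toWitness checks
    in record
      { ≈₁⇒≡ = λ { (refl , refl) → refl }
      ; ≡⇒≈₁ = λ { refl → refl , refl }
      ; ≈₂⇒≡ = λ { (refl , refl) → refl }
      ; ≡⇒≈₂ = λ { refl → refl , refl }
      ; ∙₁-identityʳ = ∙₁-identityʳ
      ; isCommutativeMonoid = record
        { isMonoid = record
          { isSemigroup = record
            { isMagma = record { isEquivalence = isEquivalence ; ∙-cong = cong₂ _∙_ }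
            ; assoc = assoc }
          ; identity = identityˡ , identityʳ }
        ; comm = comm }
      ; ∙₂-cancelˡ = cancelˡ
      ; π = π
      ; π-∙ = π-∙
      ; π-ε = π-ε
      ; lift = lift
      ; π∘lift = π∘lift
      ; lift∘π = lift∘π
      ; ker-torsion₂ = ker-torsion₂
      ; ρ = ρ
      ; ρ-ker = ρ-ker
      ; ρ-injective = ρ-injective
      ; ρ-surjective = ρ-surjective
      ; ρ-sum = ρ-sum
      }

kleinExtension-2^ : ∀ {α β} → α ≡ 1 ⊎ α ≡ 2 → β ≡ 1 ⊎ β ≡ 2 →
                    KleinExtension (Z (2 ^ (α ∸ 1)) ⊕ Z (2 ^ (β ∸ 1))) (Z (2 ^ α) ⊕ Z (2 ^ β))
kleinExtension-2^ (inj₁ refl) (inj₁ refl) = KleinFour.kleinExtension halving₂ halving₂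
kleinExtension-2^ (inj₁ refl) (inj₂ refl) = KleinFour.kleinExtension halving₂ halving₄
kleinExtension-2^ (inj₂ refl) (inj₁ refl) = KleinFour.kleinExtension halving₄ halving₂
kleinExtension-2^ (inj₂ refl) (inj₂ refl) = KleinFour.kleinExtension halving₄ halving₄

odd⇒≡1+m+m : ∀ n → ¬ 2 ∣ n → ∃[ m ] n ≡ suc (m + m)
odd⇒≡1+m+m zero          n-odd = ⊥-elim (n-odd (divides 0 refl))
odd⇒≡1+m+m (suc zero)    _     = 0 , refl
odd⇒≡1+m+m (suc (suc n)) n-odd with m , refl ← odd⇒≡1+m+m n (n-odd ∘ ∣m∣n⇒∣m+n ∣-refl) =
  suc m , cong (2 +_) (sym (+-suc m m))

oddPrime⇒≡3+m+m : ∀ {p} → Prime p → ¬ 2 ∣ p → ∃[ m ] p ≡ 3 + (m + m)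
oddPrime⇒≡3+m+m {p} p-prime p-odd with odd⇒≡1+m+m p p-odd
... | zero  , refl = ⊥-elim (¬prime[1] p-prime)
... | suc m , refl = m , cong (2 +_) (+-suc m m)

quadruple-count : ∀ p {{_ : NonZero p}} n a b z → z * (p * 4) ≡ p * (n * (a * b)) →
                  (p * n * (2 * a) * (2 * b)) div (4 * p) ≡ z * 4
quadruple-count p@(suc _) n a b z size = trans (cong (_div (4 * p)) total) (m*n/n≡m (z * 4) (4 * p))
  where
  open +-*-Solver
  open ≡-Reasoning
  total : p * n * (2 * a) * (2 * b) ≡ z * 4 * (4 * p)
  total = begin
    p * n * (2 * a) * (2 * b)
      ≡⟨ solve 4 (λ p n a b → p :* n :* (con 2 :* a) :* (con 2 :* b) := con 4 :* (p :* (n :* (a :* b))))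
               refl p n a b ⟩
    4 * (p * (n * (a * b)))
      ≡⟨ cong (4 *_) (sym size) ⟩
    4 * (z * (p * 4))
      ≡⟨ solve 2 (λ z p → con 4 :* (z :* (p :* con 4)) := z :* con 4 :* (con 4 :* p)) refl z p ⟩
    z * 4 * (4 * p) ∎

2^≡2*2^∸1 : ∀ {α} → α ≡ 1 ⊎ α ≡ 2 → 2 ^ α ≡ 2 * 2 ^ (α ∸ 1)
2^≡2*2^∸1 (inj₁ refl) = refl
2^≡2*2^∸1 (inj₂ refl) = refl

mainTheorem5 : ∀ {c ℓ} (p : ℕ) → Prime p → ¬ (2 ∣ p) →
    (H : AbelianGroup c ℓ) (n : ℕ) → HasOrder H n →
    (α β : ℕ) → (α ≡ 1 ⊎ α ≡ 2) → (β ≡ 1 ⊎ β ≡ 2) →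
    MRS* (G₁ p H α β) p 4 ((p * n * 2 ^ (α ∸ 1) * 2 ^ (β ∸ 1)) div (4 * p)) →
    MRS* (G₂ p H α β) p 4 ((p * n * 2 ^ α * 2 ^ β) div (4 * p))
mainTheorem5 p p-prime p-odd H n H-order α β α∈ β∈ M₁ =
  subst (MRS* (G₂ p H α β) p 4) (sym arrays)
    (Lifting.liftMRS* (Z p) (fromAbelianGroup H) (kleinExtension-2^ α∈ β∈)
                      (oddPrime⇒≡3+m+m p-prime p-odd) M₁)
  where
  instance
    p≢0 : NonZero p
    p≢0 = prime⇒nonZero p-prime

  a : ℕ
  a = 2 ^ (α ∸ 1)

  b : ℕ
  b = 2 ^ (β ∸ 1)

  arrays : (p * n * 2 ^ α * 2 ^ β) div (4 * p) ≡ (p * n * a * b) div (4 * p) * 4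
  arrays = trans (cong₂ (λ u v → (p * n * u * v) div (4 * p)) (2^≡2*2^∸1 α∈) (2^≡2*2^∸1 β∈)) $
           quadruple-count p n a b ((p * n * a * b) div (4 * p)) $
           enumeration-size-unique (G₁-isEquivalence p H α β) (MRS*-enumeration M₁)
                                   (G₁-enumeration p H H-order α β)
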